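{- Let $t,\lambda$ be positive integers with $t\ge 3$, and let $D$ be a diregular $(t,\lambda)$-liking digraph. Then $D$ is isomorphic to the complete digraph $\overleftrightarrow{K}_{t+\lambda}$ on $t+\lambda$ vertices.
   Context: All digraphs are finite and have no loops and no multiple arcs. A digraph $D$ is a $(t,\lambda)$-liking digraph if every set of $t$ distinct vertices of $D$ has exactly $\lambda$ common out-neighbors (the definition presumes $D$ has at least $t$ vertices). A digraph is diregular if there is a positive integer $k$ such that every vertex has out-degree $k$ and in-degree $k$. $\overleftrightarrow{K}_n$ is the digraph on $n$ vertices with both arcs between every pair of distinct vertices. -}

module Defs where

open import Data.Nat using (ℕ; zero; suc; _+_; _≤_; _<_)
open import Data.Fin using (Fin; zero; suc)
open import Data.Fin.Properties using (_≟_)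
open import Data.Bool using (Bool; true; false; if_then_else_; not; T)
open import Data.Product using (Σ; _×_; _,_; ∃-syntax)
open import Relation.Binary.PropositionalEquality using (_≡_; refl)
open import Relation.Nullary using (yes; no)
open import Data.Empty using (⊥-elim)
open import Relation.Nullary.Decidable using (⌊_⌋)
open import Function.Definitions using (Injective)
open import Function.Bundles using (_↔_; Inverse)

count : ∀ {n} → (Fin n → Bool) → ℕ
count {zero}  p = 0
count {suc n} p = (if p zero then 1 else 0) + count (λ i → p (suc i))

record Digraph (n : ℕ) : Set where
  field
    arc     : Fin n → Fin n → Bool
    loopless : ∀ v → arc v v ≡ false
open Digraph public

outdeg : ∀ {n} → Digraph n → Fin n → ℕ
outdeg D v = count (λ w → arc D v w)

indeg : ∀ {n} → Digraph n → Fin n → ℕ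
indeg D v = count (λ u → arc D u v)

Diregular : ∀ {n} → Digraph n → Set
Diregular {n} D = ∃[ k ] (0 < k × (∀ v → outdeg D v ≡ k × indeg D v ≡ k))

commonOut : ∀ {n t} → Digraph n → (Fin t → Fin n) → ℕ
commonOut {t = t} D S = count (λ w → allFin (λ i → arc D (S i) w))
  where
  allFin : ∀ {m} → (Fin m → Bool) → Bool
  allFin {zero}  p = true
  allFin {suc m} p = if p zero then allFin (λ i → p (suc i)) else false

Liking : ∀ {n} → ℕ → ℕ → Digraph n → Set
Liking {n} t l D =
  t ≤ n × ((S : Fin t → Fin n) → Injective _≡_ _≡_ S → commonOut D S ≡ l)

complete : (m : ℕ) → Digraph m
complete m = record { arc = λ u v → not ⌊ u ≟ v ⌋ ; loopless = lem }
  where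
  lem : ∀ v → not ⌊ v ≟ v ⌋ ≡ false
  lem v with v ≟ v
  ... | yes _ = refl
  ... | no ¬p = ⊥-elim (¬p refl)

_≅_ : ∀ {n m} → Digraph n → Digraph m → Set
_≅_ {n} {m} D E = Σ (Fin n ↔ Fin m) λ f →
  ∀ u v → arc D u v ≡ arc E (Inverse.to f u) (Inverse.to f v)

-- Fix t − 2 distinct vertices T. Each common out-neighbour w of T gives a block, the set
-- of in-neighbours of w outside T, and these blocks form a 2-design on the vertices outside
-- T: in-regularity fixes the block size, and (t, λ)-liking says that any two vertices
-- outside T lie in exactly λ blocks. By Fisher's inequality there are at least as many
-- blocks as points; since D has no loops, the blocks are indexed by vertices outside T, so
-- every vertex outside T is a common out-neighbour of T. As t ≥ 3, choosing T ∋ u with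
-- v ∉ T gives the arc u → v for all u ≠ v. Hence D is complete, and then any t vertices
-- have n − t common out-neighbours, so n = t + λ.

module Submission where

open import Defs
open import Algebra.Bundles using (CommutativeMonoid)
open import Data.Bool using (Bool; true; false; if_then_else_; not; _∧_)
open import Data.Bool.Properties
  using (∧-assoc; ∧-idem; ∧-identityʳ; ∧-conicalˡ; ∧-conicalʳ; ∧-commutativeMonoid)
open import Data.Empty using (⊥-elim)
open import Data.Fin as Fin using (Fin; zero; suc; punchIn; punchOut; inject≤)
open import Data.Fin.Properties
  using (_≟_; 0≢1+n; suc-injective; punchIn-injective; punchInᵢ≢i; punchIn-punchOut; inject≤-injective)
open import Data.Nat
  using (ℕ; zero; suc; _+_; _*_; _∸_; pred; _≤_; _<_; z≤n; s≤s; NonZero; >-nonZero; >-nonZero⁻¹)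
open import Data.Nat.Properties
  using ( +-*-semiring; module ≤-Reasoning
        ; +-comm; +-suc; +-identityʳ; +-mono-≤; +-cancelʳ-≡; +-cancelˡ-≤
        ; *-comm; *-identityʳ; *-identityˡ; *-mono-≤; *-monoʳ-≤; *-cancelʳ-≡; *-cancelʳ-≤; *-cancelˡ-≤
        ; ≤-refl; ≤-reflexive; ≤-trans; ≤-total; <-irrefl; <⇒≱; ≮⇒≥; n<1+n; n≤1+n; m≤m+n; m<m+n
        ; pred-mono-≤; pred[n]≤n; m*n≢0⇒m≢0; m*n≢0⇒n≢0; m+n∸m≡n; m<n+o⇒m∸n<o; m≤n⇒∃[o]m+o≡n )
open import Data.Nat.Tactic.RingSolver using (solve-∀)
open import Data.Product using (∃-syntax; _×_; _,_; proj₁; proj₂)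
open import Data.Sum using ([_,_]′)
open import Data.Vec.Functional using (foldr; _∷_)
open import Function using (_∘_)
open import Function.Construct.Identity using (↔-id)
open import Function.Definitions using (Injective)
open import Relation.Binary.PropositionalEquality
open import Relation.Nullary using (yes; no; ¬_)
open import Relation.Nullary.Decidable using (⌊_⌋; ⌊⌋-map′)

open import Algebra.Properties.Semiring.Sum +-*-semiring
  using (sum; sum-syntax; sum-cong-≗; sum-replicate-zero; ∑-comm; ∑-distrib-+; *-distribˡ-sum; *-distribʳ-sum)
open import Algebra.Properties.CommutativeSemigroup
  (CommutativeMonoid.commutativeSemigroup ∧-commutativeMonoid)
  using (x∙yz≈y∙xz)

-- Counting with Boolean predicates on Fin n

𝟙 : Bool → ℕ
𝟙 b = if b then 1 else 0

∑⟨_⟩_ : ∀ {n} → (Fin n → Bool) → (Fin n → ℕ) → ℕ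
∑⟨_⟩_ {n} p f = ∑[ i < n ] (𝟙 (p i) * f i)

_⊆_ : ∀ {n} → (Fin n → Bool) → (Fin n → Bool) → Set
p ⊆ q = ∀ i → p i ≡ true → q i ≡ true

_∖_ : ∀ {n} → (Fin n → Bool) → Fin n → Fin n → Bool
(p ∖ a) i = not ⌊ a ≟ i ⌋ ∧ p i

≢⇒not⌊≟⌋ : ∀ {n} {x y : Fin n} → x ≢ y → not ⌊ x ≟ y ⌋ ≡ true
≢⇒not⌊≟⌋ {x = x} {y} x≢y with x ≟ y
... | yes x≡y = ⊥-elim (x≢y x≡y)
... | no _    = refl

not⌊≟⌋⇒≢ : ∀ {n} {x y : Fin n} → not ⌊ x ≟ y ⌋ ≡ true → x ≢ y
not⌊≟⌋⇒≢ {x = x} _ refl with x ≟ x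
not⌊≟⌋⇒≢ () refl | yes _
not⌊≟⌋⇒≢ _  refl | no x≢x = x≢x refl

∈∖⇒≢ : ∀ {n} (p : Fin n → Bool) a {i} → (p ∖ a) i ≡ true → i ≢ a
∈∖⇒≢ p a {i} i∈p∖a = ≢-sym (not⌊≟⌋⇒≢ (∧-conicalˡ (not ⌊ a ≟ i ⌋) (p i) i∈p∖a))

∈∖⇒∈ : ∀ {n} (p : Fin n → Bool) a {i} → (p ∖ a) i ≡ true → p i ≡ true
∈∖⇒∈ p a {i} i∈p∖a = ∧-conicalʳ (not ⌊ a ≟ i ⌋) (p i) i∈p∖a

count-sum : ∀ {n} (p : Fin n → Bool) → count p ≡ ∑[ i < n ] 𝟙 (p i)
count-sum {zero}  p = refl
count-sum {suc n} p = cong (𝟙 (p zero) +_) (count-sum (λ i → p (suc i)))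

count≡∑⟨⟩ : ∀ {n} (p : Fin n → Bool) → count p ≡ ∑⟨ p ⟩ (λ _ → 1)
count≡∑⟨⟩ p = trans (count-sum p) (sum-cong-≗ (λ i → sym (*-identityʳ (𝟙 (p i)))))

count-cong : ∀ {n} {p q : Fin n → Bool} → (∀ i → p i ≡ q i) → count p ≡ count q
count-cong {n} {p} {q} p≗q = begin
  count p             ≡⟨ count-sum p ⟩
  ∑[ i < n ] 𝟙 (p i)  ≡⟨ sum-cong-≗ (cong 𝟙 ∘ p≗q) ⟩
  ∑[ i < n ] 𝟙 (q i)  ≡⟨ count-sum q ⟨
  count q             ∎
  where open ≡-Reasoning

count-true : ∀ {n} → count {n} (λ _ → true) ≡ n
count-true {zero}  = refl
count-true {suc n} = cong suc count-true

count-pos : ∀ {n} (p : Fin n → Bool) → 0 < count p → ∃[ i ] p i ≡ true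
count-pos {suc n} p 0<count with p zero in p0
... | true  = zero , p0
... | false with count-pos (λ i → p (suc i)) 0<count
...   | i , pi = suc i , pi

∑⟨⟩-split : ∀ {n} (q p : Fin n → Bool) (f : Fin n → ℕ) →
            ∑⟨ p ⟩ f ≡ ∑⟨ (λ i → q i ∧ p i) ⟩ f + ∑⟨ (λ i → not (q i) ∧ p i) ⟩ f
∑⟨⟩-split q p f = trans (sum-cong-≗ split)
  (∑-distrib-+ (λ i → 𝟙 (q i ∧ p i) * f i) (λ i → 𝟙 (not (q i) ∧ p i) * f i))
  where
  split : ∀ i → 𝟙 (p i) * f i ≡ 𝟙 (q i ∧ p i) * f i + 𝟙 (not (q i) ∧ p i) * f i
  split i with q i
  ... | true  = sym (+-identityʳ _)
  ... | false = refl

∑-singleton : ∀ {n} (a : Fin n) (f : Fin n → ℕ) → ∑[ i < n ] (𝟙 ⌊ a ≟ i ⌋ * f i) ≡ f a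
∑-singleton {suc n} zero    f =
  trans (cong (1 * f zero +_) (sum-replicate-zero n)) (trans (+-identityʳ _) (*-identityˡ _))
∑-singleton {suc n} (suc a) f =
  trans (sum-cong-≗ (λ i → cong (λ b → 𝟙 b * f (suc i)) (⌊⌋-map′ _ _ (a ≟ i))))
        (∑-singleton a (λ i → f (suc i)))

∑⟨⟩-remove : ∀ {n} (p : Fin n → Bool) (f : Fin n → ℕ) {a} → p a ≡ true →
             ∑⟨ p ⟩ f ≡ f a + ∑⟨ p ∖ a ⟩ f
∑⟨⟩-remove p f {a} pa = trans (∑⟨⟩-split (λ i → ⌊ a ≟ i ⌋) p f)
  (cong (_+ ∑⟨ p ∖ a ⟩ f) (trans (sum-cong-≗ only-a) (∑-singleton a f)))
  where
  only-a : ∀ i → 𝟙 (⌊ a ≟ i ⌋ ∧ p i) * f i ≡ 𝟙 ⌊ a ≟ i ⌋ * f i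
  only-a i with a ≟ i
  ... | yes refl = cong (λ b → 𝟙 b * f i) pa
  ... | no _     = refl

count-remove : ∀ {n} (p : Fin n → Bool) {a} → p a ≡ true → count p ≡ suc (count (p ∖ a))
count-remove p {a} pa = begin
  count p                        ≡⟨ count≡∑⟨⟩ p ⟩
  ∑⟨ p ⟩ (λ _ → 1)               ≡⟨ ∑⟨⟩-remove p (λ _ → 1) pa ⟩
  suc (∑⟨ p ∖ a ⟩ (λ _ → 1))     ≡⟨ cong suc (count≡∑⟨⟩ (p ∖ a)) ⟨
  suc (count (p ∖ a))            ∎
  where open ≡-Reasoning

∑⟨⟩-const : ∀ {n} (p : Fin n → Bool) {f : Fin n → ℕ} {c} → (∀ i → p i ≡ true → f i ≡ c) →
            ∑⟨ p ⟩ f ≡ count p * c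
∑⟨⟩-const p {f} {c} f≡c = begin
  ∑⟨ p ⟩ f                  ≡⟨ sum-cong-≗ on-support ⟩
  ∑[ i < _ ] (𝟙 (p i) * c)  ≡⟨ *-distribʳ-sum c (λ i → 𝟙 (p i)) ⟨
  ∑[ i < _ ] 𝟙 (p i) * c    ≡⟨ cong (_* c) (count-sum p) ⟨
  count p * c               ∎
  where
  open ≡-Reasoning
  on-support : ∀ i → 𝟙 (p i) * f i ≡ 𝟙 (p i) * c
  on-support i with p i in pi
  ... | true  = cong (_+ 0) (f≡c i pi)
  ... | false = refl

∑-mono-≤ : ∀ {n} {f g : Fin n → ℕ} → (∀ i → f i ≤ g i) → ∑[ i < n ] f i ≤ ∑[ i < n ] g i
∑-mono-≤ {zero}  f≤g = z≤n
∑-mono-≤ {suc n} f≤g = +-mono-≤ (f≤g zero) (∑-mono-≤ (λ i → f≤g (suc i)))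

count-mono : ∀ {n} {p q : Fin n → Bool} → p ⊆ q → count p ≤ count q
count-mono {n} {p} {q} p⊆q = begin
  count p             ≡⟨ count-sum p ⟩
  ∑[ i < n ] 𝟙 (p i)  ≤⟨ ∑-mono-≤ (λ i → 𝟙-mono (p⊆q i)) ⟩
  ∑[ i < n ] 𝟙 (q i)  ≡⟨ count-sum q ⟨
  count q             ∎
  where
  open ≤-Reasoning
  𝟙-mono : ∀ {a b} → (a ≡ true → b ≡ true) → 𝟙 a ≤ 𝟙 b
  𝟙-mono {false} _   = z≤n
  𝟙-mono {true}  a⇒b rewrite a⇒b refl = ≤-refl

count-⊂ : ∀ {n} {p q : Fin n → Bool} {a} → p ⊆ q → q a ≡ true → p a ≡ false → count p < count q
count-⊂ {p = p} {q} {a} p⊆q qa pa = begin-strict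
  count p              ≤⟨ count-mono p⊆q∖a ⟩
  count (q ∖ a)        <⟨ n<1+n _ ⟩
  suc (count (q ∖ a))  ≡⟨ count-remove q qa ⟨
  count q              ∎
  where
  open ≤-Reasoning
  p⊆q∖a : p ⊆ (q ∖ a)
  p⊆q∖a i pi with a ≟ i
  ... | yes refl with () ← trans (sym pi) pa
  ... | no _     = p⊆q i pi

⊆∧count≥⇒⊇ : ∀ {n} {p q : Fin n → Bool} → p ⊆ q → count q ≤ count p → q ⊆ p
⊆∧count≥⇒⊇ {p = p} p⊆q q≤p i qi with p i in pi
... | true  = refl
... | false = ⊥-elim (<⇒≱ (count-⊂ p⊆q qi pi) q≤p)

-- Double counting and the Cauchy–Schwarz inequality

module _ {n m} (P : Fin n → Bool) (B : Fin m → Bool) (R : Fin n → Fin m → Bool) where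

  double-count-weighted : (f : Fin m → ℕ) →
    ∑⟨ B ⟩ (λ w → count (λ x → P x ∧ R x w) * f w) ≡ ∑⟨ P ⟩ (λ x → ∑⟨ (λ w → R x w ∧ B w) ⟩ f)
  double-count-weighted f = begin
    ∑[ w < m ] (𝟙 (B w) * (count (λ x → P x ∧ R x w) * f w))
      ≡⟨ sum-cong-≗ expand ⟩
    ∑[ w < m ] ∑[ x < n ] (𝟙 (B w) * (𝟙 (P x ∧ R x w) * f w))
      ≡⟨ sum-cong-≗ (λ w → sum-cong-≗ (λ x → shuffle (B w) (P x) (R x w) (f w))) ⟩
    ∑[ w < m ] ∑[ x < n ] (𝟙 (P x) * (𝟙 (R x w ∧ B w) * f w))
      ≡⟨ ∑-comm (λ w x → 𝟙 (P x) * (𝟙 (R x w ∧ B w) * f w)) ⟩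
    ∑[ x < n ] ∑[ w < m ] (𝟙 (P x) * (𝟙 (R x w ∧ B w) * f w))
      ≡⟨ sum-cong-≗ (λ x → *-distribˡ-sum (𝟙 (P x)) (λ w → 𝟙 (R x w ∧ B w) * f w)) ⟨
    ∑[ x < n ] (𝟙 (P x) * ∑⟨ (λ w → R x w ∧ B w) ⟩ f)
      ∎
    where
    open ≡-Reasoning
    expand : ∀ w → 𝟙 (B w) * (count (λ x → P x ∧ R x w) * f w)
                   ≡ ∑[ x < n ] (𝟙 (B w) * (𝟙 (P x ∧ R x w) * f w))
    expand w = begin
      𝟙 (B w) * (count (λ x → P x ∧ R x w) * f w)
        ≡⟨ cong (λ c → 𝟙 (B w) * (c * f w)) (count-sum (λ x → P x ∧ R x w)) ⟩
      𝟙 (B w) * (∑[ x < n ] 𝟙 (P x ∧ R x w) * f w)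
        ≡⟨ cong (𝟙 (B w) *_) (*-distribʳ-sum (f w) (λ x → 𝟙 (P x ∧ R x w))) ⟩
      𝟙 (B w) * ∑[ x < n ] (𝟙 (P x ∧ R x w) * f w)
        ≡⟨ *-distribˡ-sum (𝟙 (B w)) (λ x → 𝟙 (P x ∧ R x w) * f w) ⟩
      ∑[ x < n ] (𝟙 (B w) * (𝟙 (P x ∧ R x w) * f w))
        ∎
    shuffle : ∀ b p r c → 𝟙 b * (𝟙 (p ∧ r) * c) ≡ 𝟙 p * (𝟙 (r ∧ b) * c)
    shuffle false false _     _ = refl
    shuffle false true  false _ = refl
    shuffle false true  true  _ = refl
    shuffle true  false _     _ = refl
    shuffle true  true  false _ = refl
    shuffle true  true  true  _ = refl

  double-count : ∑⟨ B ⟩ (λ w → count (λ x → P x ∧ R x w)) ≡ ∑⟨ P ⟩ (λ x → count (λ w → R x w ∧ B w))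
  double-count = begin
    ∑⟨ B ⟩ (λ w → count (λ x → P x ∧ R x w))
      ≡⟨ sum-cong-≗ (λ w → cong (𝟙 (B w) *_) (*-identityʳ _)) ⟨
    ∑⟨ B ⟩ (λ w → count (λ x → P x ∧ R x w) * 1)
      ≡⟨ double-count-weighted (λ _ → 1) ⟩
    ∑⟨ P ⟩ (λ x → ∑⟨ (λ w → R x w ∧ B w) ⟩ (λ _ → 1))
      ≡⟨ sum-cong-≗ (λ x → cong (𝟙 (P x) *_) (count≡∑⟨⟩ (λ w → R x w ∧ B w))) ⟨
    ∑⟨ P ⟩ (λ x → count (λ w → R x w ∧ B w))
      ∎
    where open ≡-Reasoning

  biregular-count : ∀ {K r} → (∀ w → B w ≡ true → count (λ x → P x ∧ R x w) ≡ K) →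
                    (∀ x → P x ≡ true → count (λ w → R x w ∧ B w) ≡ r) → count B * K ≡ count P * r
  biregular-count {K} {r} blocks points = begin
    count B * K                                ≡⟨ ∑⟨⟩-const B blocks ⟨
    ∑⟨ B ⟩ (λ w → count (λ x → P x ∧ R x w))   ≡⟨ double-count ⟩
    ∑⟨ P ⟩ (λ x → count (λ w → R x w ∧ B w))   ≡⟨ ∑⟨⟩-const P points ⟩
    count P * r                                ∎
    where open ≡-Reasoning

2[m*n]≤m*m+n*n : ∀ m n → 2 * (m * n) ≤ m * m + n * n
2[m*n]≤m*m+n*n m n = [ ordered , flipped ]′ (≤-total m n)
  where
  gap : ∀ m d → 2 * (m * (m + d)) + d * d ≡ m * m + (m + d) * (m + d)
  gap = solve-∀
  ordered : ∀ {m n} → m ≤ n → 2 * (m * n) ≤ m * m + n * n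
  ordered {m} m≤n with m≤n⇒∃[o]m+o≡n m≤n
  ... | d , refl = ≤-trans (m≤m+n _ (d * d)) (≤-reflexive (gap m d))
  flipped : n ≤ m → 2 * (m * n) ≤ m * m + n * n
  flipped n≤m = subst₂ _≤_ (cong (2 *_) (*-comm n m)) (+-comm (n * n) (m * m)) (ordered n≤m)

∑-*-∑ : ∀ {m n} (f : Fin m → ℕ) (g : Fin n → ℕ) → sum f * sum g ≡ ∑[ i < m ] ∑[ j < n ] (f i * g j)
∑-*-∑ f g = trans (*-distribʳ-sum (sum g) f) (sum-cong-≗ (λ i → *-distribˡ-sum (f i) g))

cauchy-schwarz : ∀ {n} (a x : Fin n → ℕ) →
  ∑[ i < n ] (a i * x i) * ∑[ i < n ] (a i * x i) ≤ ∑[ i < n ] a i * ∑[ i < n ] (a i * (x i * x i))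
cauchy-schwarz {n} a x = *-cancelˡ-≤ 2 (begin
  2 * (sum ax * sum ax)
    ≡⟨ cong (2 *_) (∑-*-∑ ax ax) ⟩
  2 * ∑[ i < n ] ∑[ j < n ] (ax i * ax j)
    ≡⟨ trans (*-distribˡ-sum 2 (λ i → ∑[ j < n ] (ax i * ax j)))
             (sum-cong-≗ (λ i → *-distribˡ-sum 2 (λ j → ax i * ax j))) ⟩
  ∑[ i < n ] ∑[ j < n ] (2 * (ax i * ax j))
    ≤⟨ ∑-mono-≤ (λ i → ∑-mono-≤ (pairwise i)) ⟩
  ∑[ i < n ] ∑[ j < n ] (a i * axx j + a j * axx i)
    ≡⟨ sum-cong-≗ (λ i → ∑-distrib-+ (λ j → a i * axx j) (λ j → a j * axx i)) ⟩
  ∑[ i < n ] (∑[ j < n ] (a i * axx j) + ∑[ j < n ] (a j * axx i))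
    ≡⟨ ∑-distrib-+ (λ i → ∑[ j < n ] (a i * axx j)) (λ i → ∑[ j < n ] (a j * axx i)) ⟩
  ∑[ i < n ] ∑[ j < n ] (a i * axx j) + ∑[ i < n ] ∑[ j < n ] (a j * axx i)
    ≡⟨ cong (∑[ i < n ] ∑[ j < n ] (a i * axx j) +_) (∑-comm (λ i j → a j * axx i)) ⟩
  ∑[ i < n ] ∑[ j < n ] (a i * axx j) + ∑[ j < n ] ∑[ i < n ] (a j * axx i)
    ≡⟨ cong₂ _+_ (∑-*-∑ a axx) (∑-*-∑ a axx) ⟨
  sum a * sum axx + sum a * sum axx
    ≡⟨ cong (sum a * sum axx +_) (+-identityʳ (sum a * sum axx)) ⟨
  2 * (sum a * sum axx)
    ∎)
  where
  open ≤-Reasoning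
  ax axx : Fin n → ℕ
  ax i = a i * x i
  axx i = a i * (x i * x i)
  regroup₁ : ∀ ai aj xi xj → 2 * (ai * xi * (aj * xj)) ≡ (ai * aj) * (2 * (xi * xj))
  regroup₁ = solve-∀
  regroup₂ : ∀ ai aj xi xj → (ai * aj) * (xi * xi + xj * xj) ≡ ai * (aj * (xj * xj)) + aj * (ai * (xi * xi))
  regroup₂ = solve-∀
  pairwise : ∀ i j → 2 * (ax i * ax j) ≤ a i * axx j + a j * axx i
  pairwise i j = begin
    2 * (ax i * ax j)                      ≡⟨ regroup₁ (a i) (a j) (x i) (x j) ⟩
    (a i * a j) * (2 * (x i * x j))        ≤⟨ *-monoʳ-≤ (a i * a j) (2[m*n]≤m*m+n*n (x i) (x j)) ⟩
    (a i * a j) * (x i * x i + x j * x j)  ≡⟨ regroup₂ (a i) (a j) (x i) (x j) ⟩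
    a i * axx j + a j * axx i              ∎

-- Fisher's inequality

-- The parameters of a 2-design: b blocks of size K on N points, every point in r blocks and
-- every pair of points in l blocks; `pred x` stands for x − 1.
fisher-arithmetic : ∀ {b K N r l} → b * K ≡ N * r → r * pred K ≡ pred N * l →
  (K * pred r) * (K * pred r) ≤ pred b * (K * (pred r + pred K * pred l)) →
  0 < K → 0 < r → 0 < l → K < N → N ≤ b
fisher-arithmetic {K = zero} _ _ _ () _ _ _
fisher-arithmetic {r = zero} _ _ _ _ () _ _
fisher-arithmetic {l = zero} _ _ _ _ _ () _
fisher-arithmetic {N = zero} _ _ _ _ _ _ ()
fisher-arithmetic {zero} {suc _} {suc _} {suc _} {suc _} () _ _ _ _ _ _
fisher-arithmetic {suc b} {suc K} {suc N} {suc r} {suc l} incidences pairs variance _ _ _ (s≤s K<N) =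
  *-cancelʳ-≤ (suc N) (suc b) (suc K) (begin
    suc N * suc K  ≤⟨ *-monoʳ-≤ (suc N) (s≤s (≮⇒≥ r≮K)) ⟩
    suc N * suc r  ≡⟨ incidences ⟨
    suc b * suc K  ∎)
  where
  open ≤-Reasoning
  -- In the unshifted parameters, (N − 1) times the slack in `variance` equals
  -- r (r − K) (N − K)² modulo `incidences` and `pairs`, so r < K is impossible.
  -- `certificate` is this identity in the shifted ones, with K − r = suc e and N − K = suc f,
  -- and with every term moved to the side where it is added.
  certificate : ∀ b r e f l →
    let K = suc r + e; N = suc K + f; Q = r + K * l; c = (N * r + r + suc f) * K in
    (N * (b * (suc K * Q)) + suc r * (suc e * (suc f * suc f)))
      + (N * Q * (suc N * suc r) + c * (suc r * K))
    ≡ N * ((suc K * r) * (suc K * r)) + (N * Q * (suc b * suc K) + c * (N * suc l))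
  certificate = solve-∀
  r≮K : ¬ r < K
  r≮K r<K with m≤n⇒∃[o]m+o≡n r<K | m≤n⇒∃[o]m+o≡n K<N
  ... | e , refl | f , refl = <-irrefl refl (begin-strict
    N * ((suc K * r) * (suc K * r))                            ≤⟨ *-monoʳ-≤ N variance ⟩
    N * (b * (suc K * Q))                                      <⟨ m<m+n _ (s≤s z≤n) ⟩
    N * (b * (suc K * Q)) + suc r * (suc e * (suc f * suc f))  ≡⟨ +-cancelʳ-≡ _ _ _ balanced ⟩
    N * ((suc K * r) * (suc K * r))                            ∎)
    where
    Q = r + K * l
    c = (N * r + r + suc f) * K
    balanced : (N * (b * (suc K * Q)) + suc r * (suc e * (suc f * suc f)))
                 + (N * Q * (suc N * suc r) + c * (suc r * K))
               ≡ N * ((suc K * r) * (suc K * r)) + (N * Q * (suc N * suc r) + c * (suc r * K))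
    balanced = trans (certificate b r e f l)
      (cong₂ (λ u v → N * ((suc K * r) * (suc K * r)) + (N * Q * u + c * v)) incidences (sym pairs))

module Fisher {n m} (P : Fin n → Bool) (B : Fin m → Bool) (R : Fin n → Fin m → Bool) {K l : ℕ}
  (block-size : ∀ w → B w ≡ true → count (λ x → P x ∧ R x w) ≡ K)
  (pair-count : ∀ x y → P x ≡ true → P y ≡ true → x ≢ y →
                count (λ w → R x w ∧ (R y w ∧ B w)) ≡ l)
  (0<l : 0 < l) (2≤N : 2 ≤ count P)
  where

  replication : ∀ x → P x ≡ true → count (λ w → R x w ∧ B w) * pred K ≡ pred (count P) * l
  replication x Px = trans (biregular-count (P ∖ x) (λ w → R x w ∧ B w) R block-without-x pair-with-x)
                           (sym (cong (λ c → pred c * l) (count-remove P Px)))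
    where
    open ≡-Reasoning
    block-without-x : ∀ w → R x w ∧ B w ≡ true → count (λ y → (P ∖ x) y ∧ R y w) ≡ pred K
    block-without-x w xw = begin
      count (λ y → (P ∖ x) y ∧ R y w)
        ≡⟨ count-cong (λ y → ∧-assoc (not ⌊ x ≟ y ⌋) (P y) (R y w)) ⟩
      count ((λ y → P y ∧ R y w) ∖ x)
        ≡⟨ cong pred (count-remove (λ y → P y ∧ R y w) (cong₂ _∧_ Px (∧-conicalˡ (R x w) _ xw))) ⟨
      pred (count (λ y → P y ∧ R y w))
        ≡⟨ cong pred (block-size w (∧-conicalʳ (R x w) _ xw)) ⟩
      pred K
        ∎
    pair-with-x : ∀ y → (P ∖ x) y ≡ true → count (λ w → R y w ∧ (R x w ∧ B w)) ≡ l
    pair-with-x y y∈P∖x = pair-count y x (∈∖⇒∈ P x y∈P∖x) Px (∈∖⇒≢ P x y∈P∖x)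

  private
    some-point : ∃[ x ] P x ≡ true
    some-point = count-pos P (≤-trans (s≤s z≤n) 2≤N)

    x₀ : Fin n
    x₀ = proj₁ some-point

    r : ℕ
    r = count (λ w → R x₀ w ∧ B w)

    r*predK>0 : 0 < r * pred K
    r*predK>0 = subst (0 <_) (sym (replication x₀ (proj₂ some-point))) (*-mono-≤ (pred-mono-≤ 2≤N) 0<l)

    instance
      predK≢0 : NonZero (pred K)
      predK≢0 = m*n≢0⇒n≢0 r {{>-nonZero r*predK>0}}

    0<r : 0 < r
    0<r = >-nonZero⁻¹ r {{m*n≢0⇒m≢0 r {{>-nonZero r*predK>0}}}}

  replication-const : ∀ x → P x ≡ true → count (λ w → R x w ∧ B w) ≡ r
  replication-const x Px =
    *-cancelʳ-≡ _ _ (pred K) (trans (replication x Px) (sym (replication x₀ (proj₂ some-point))))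

  incidences : count B * K ≡ count P * r
  incidences = biregular-count P B R block-size replication-const

  -- The variance method: X w counts the points that a block w shares with a fixed block w₀;
  -- the first two moments of X over the other blocks are found by double counting and
  -- compared by Cauchy–Schwarz.
  private
    some-block : ∃[ w ] R x₀ w ∧ B w ≡ true
    some-block = count-pos (λ w → R x₀ w ∧ B w) 0<r

    w₀ : Fin m
    w₀ = proj₁ some-block

    Bw₀ : B w₀ ≡ true
    Bw₀ = ∧-conicalʳ (R x₀ w₀) _ (proj₂ some-block)

    I : Fin m → Bool
    I = B ∖ w₀

    P₀ : Fin n → Bool
    P₀ x = P x ∧ R x w₀

    X : Fin m → ℕ
    X w = count (λ x → P₀ x ∧ R x w)

    P₀⇒P : ∀ {x} → P₀ x ≡ true → P x ≡ true
    P₀⇒P {x} = ∧-conicalˡ (P x) (R x w₀)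

    P₀⇒R : ∀ {x} → P₀ x ≡ true → R x w₀ ≡ true
    P₀⇒R {x} = ∧-conicalʳ (P x) (R x w₀)

    count-P₀ : count P₀ ≡ K
    count-P₀ = block-size w₀ Bw₀

    replication-I : ∀ x → P₀ x ≡ true → count (λ w → R x w ∧ I w) ≡ pred r
    replication-I x x∈P₀ = begin
      count (λ w → R x w ∧ I w)
        ≡⟨ count-cong (λ w → x∙yz≈y∙xz (not ⌊ w₀ ≟ w ⌋) (R x w) (B w)) ⟨
      count ((λ w → R x w ∧ B w) ∖ w₀)
        ≡⟨ cong pred (count-remove (λ w → R x w ∧ B w) (cong₂ _∧_ (P₀⇒R x∈P₀) Bw₀)) ⟨
      pred (count (λ w → R x w ∧ B w))
        ≡⟨ cong pred (replication-const x (P₀⇒P x∈P₀)) ⟩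
      pred r
        ∎
      where open ≡-Reasoning

    pair-count-I : ∀ x y → P₀ x ≡ true → P₀ y ≡ true → x ≢ y →
                   count (λ w → R x w ∧ (R y w ∧ I w)) ≡ pred l
    pair-count-I x y x∈P₀ y∈P₀ x≢y = begin
      count (λ w → R x w ∧ (R y w ∧ I w))
        ≡⟨ count-cong move-to-front ⟨
      count ((λ w → R x w ∧ (R y w ∧ B w)) ∖ w₀)
        ≡⟨ cong pred (count-remove (λ w → R x w ∧ (R y w ∧ B w))
                                   (cong₂ _∧_ (P₀⇒R x∈P₀) (cong₂ _∧_ (P₀⇒R y∈P₀) Bw₀))) ⟨
      pred (count (λ w → R x w ∧ (R y w ∧ B w)))
        ≡⟨ cong pred (pair-count x y (P₀⇒P x∈P₀) (P₀⇒P y∈P₀) x≢y) ⟩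
      pred l
        ∎
      where
      open ≡-Reasoning
      move-to-front : ∀ w → not ⌊ w₀ ≟ w ⌋ ∧ (R x w ∧ (R y w ∧ B w)) ≡ R x w ∧ (R y w ∧ I w)
      move-to-front w = trans (x∙yz≈y∙xz (not ⌊ w₀ ≟ w ⌋) (R x w) (R y w ∧ B w))
                              (cong (R x w ∧_) (x∙yz≈y∙xz (not ⌊ w₀ ≟ w ⌋) (R y w) (B w)))

    sum-X : ∑⟨ I ⟩ X ≡ K * pred r
    sum-X = begin
      ∑⟨ I ⟩ X                                    ≡⟨ double-count P₀ I R ⟩
      ∑⟨ P₀ ⟩ (λ x → count (λ w → R x w ∧ I w))   ≡⟨ ∑⟨⟩-const P₀ replication-I ⟩
      count P₀ * pred r                           ≡⟨ cong (_* pred r) count-P₀ ⟩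
      K * pred r                                  ∎
      where open ≡-Reasoning

    sum-X² : ∑⟨ I ⟩ (λ w → X w * X w) ≡ K * (pred r + pred K * pred l)
    sum-X² = begin
      ∑⟨ I ⟩ (λ w → X w * X w)                    ≡⟨ double-count-weighted P₀ I R X ⟩
      ∑⟨ P₀ ⟩ (λ x → ∑⟨ (λ w → R x w ∧ I w) ⟩ X)  ≡⟨ ∑⟨⟩-const P₀ row ⟩
      count P₀ * (pred r + pred K * pred l)       ≡⟨ cong (_* (pred r + pred K * pred l)) count-P₀ ⟩
      K * (pred r + pred K * pred l)              ∎
      where
      open ≡-Reasoning
      row : ∀ x → P₀ x ≡ true → ∑⟨ (λ w → R x w ∧ I w) ⟩ X ≡ pred r + pred K * pred l
      row x x∈P₀ = begin
        ∑⟨ (λ w → R x w ∧ I w) ⟩ X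
          ≡⟨ double-count P₀ (λ w → R x w ∧ I w) R ⟩
        ∑⟨ P₀ ⟩ (λ y → count (λ w → R y w ∧ (R x w ∧ I w)))
          ≡⟨ ∑⟨⟩-remove P₀ (λ y → count (λ w → R y w ∧ (R x w ∧ I w))) x∈P₀ ⟩
        count (λ w → R x w ∧ (R x w ∧ I w))
          + ∑⟨ P₀ ∖ x ⟩ (λ y → count (λ w → R y w ∧ (R x w ∧ I w)))
          ≡⟨ cong₂ _+_ diagonal (∑⟨⟩-const (P₀ ∖ x) off-diagonal) ⟩
        pred r + count (P₀ ∖ x) * pred l
          ≡⟨ cong (λ c → pred r + pred c * pred l) (count-remove P₀ x∈P₀) ⟨
        pred r + pred (count P₀) * pred l
          ≡⟨ cong (λ c → pred r + pred c * pred l) count-P₀ ⟩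
        pred r + pred K * pred l
          ∎
        where
        diagonal : count (λ w → R x w ∧ (R x w ∧ I w)) ≡ pred r
        diagonal = trans (count-cong (λ w → trans (sym (∧-assoc (R x w) (R x w) (I w)))
                                                  (cong (_∧ I w) (∧-idem (R x w)))))
                         (replication-I x x∈P₀)
        off-diagonal : ∀ y → (P₀ ∖ x) y ≡ true → count (λ w → R y w ∧ (R x w ∧ I w)) ≡ pred l
        off-diagonal y y∈P₀∖x =
          pair-count-I y x (∈∖⇒∈ P₀ x y∈P₀∖x) x∈P₀ (∈∖⇒≢ P₀ x y∈P₀∖x)

    variance : (K * pred r) * (K * pred r) ≤ pred (count B) * (K * (pred r + pred K * pred l))
    variance = begin
      (K * pred r) * (K * pred r)                        ≡⟨ cong₂ _*_ sum-X sum-X ⟨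
      ∑⟨ I ⟩ X * ∑⟨ I ⟩ X                                ≤⟨ cauchy-schwarz (λ w → 𝟙 (I w)) X ⟩
      ∑[ w < m ] 𝟙 (I w) * ∑⟨ I ⟩ (λ w → X w * X w)      ≡⟨ cong₂ _*_ count-I sum-X² ⟩
      pred (count B) * (K * (pred r + pred K * pred l))  ∎
      where
      open ≤-Reasoning
      count-I : ∑[ w < m ] 𝟙 (I w) ≡ pred (count B)
      count-I = trans (sym (count-sum I)) (cong pred (sym (count-remove B Bw₀)))

  fisher-inequality : K < count P → count P ≤ count B
  fisher-inequality K<N = fisher-arithmetic incidences (replication x₀ (proj₂ some-point)) variance
    (≤-trans (>-nonZero⁻¹ (pred K)) pred[n]≤n) 0<r 0<l K<N

-- Common out-neighbours of tuples of vertices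

all : ∀ {m} → (Fin m → Bool) → Bool
all = foldr _∧_ true

all-elim : ∀ {m} {p : Fin m → Bool} → all p ≡ true → ∀ i → p i ≡ true
all-elim {p = p} all-p zero    = ∧-conicalˡ (p zero) _ all-p
all-elim {p = p} all-p (suc i) = all-elim (∧-conicalʳ (p zero) _ all-p) i

all-intro : ∀ {m} {p : Fin m → Bool} → (∀ i → p i ≡ true) → all p ≡ true
all-intro {zero}  _ = refl
all-intro {suc m} h = cong₂ _∧_ (h zero) (all-intro (h ∘ suc))

all-cong : ∀ {m} {p q : Fin m → Bool} → (∀ i → p i ≡ q i) → all p ≡ all q
all-cong {zero}  _   = refl
all-cong {suc m} p≗q = cong₂ _∧_ (p≗q zero) (all-cong (p≗q ∘ suc))

isCommonOut : ∀ {n s} → Digraph n → (Fin s → Fin n) → Fin n → Bool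
isCommonOut D T w = all (λ i → arc D (T i) w)

outside : ∀ {n s} → (Fin s → Fin n) → Fin n → Bool
outside T x = all (λ i → not ⌊ T i ≟ x ⌋)

-- `commonOut` tests each vertex with a helper that is local to its definition. Unification
-- names the test and then the helper, which after the `with`s below is applied to variables
-- only.
mutual
  private
    commonOutTest : ∀ {n t} → Digraph n → (Fin t → Fin n) → Fin n → Bool
    commonOutTest = _

    commonOut≡count-test : ∀ {n t} (D : Digraph n) (S : Fin t → Fin n) →
                           commonOut D S ≡ count (commonOutTest D S)
    commonOut≡count-test D S = refl

mutual
  private
    commonOutAll : ∀ {n t} → Digraph n → (Fin t → Fin n) → ∀ {m} → (Fin m → Bool) → Bool
    commonOutAll = _

    commonOutTest-suc : ∀ {n m} (D : Digraph n) (S : Fin (suc m) → Fin n) w →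
      commonOutTest D S w ≡ (if arc D (S zero) w then commonOutAll D S (λ i → arc D (S (suc i)) w) else false)
    commonOutTest-suc {m = m} D S w with arc D (S zero) w | (λ i → arc D (S (suc i)) w)
    ... | _ | _ with suc m | S
    ... | _ | _ = refl

private
  commonOutAll≡all : ∀ {n t m} (D : Digraph n) (S : Fin t → Fin n) (p : Fin m → Bool) →
                     commonOutAll D S p ≡ all p
  commonOutAll≡all {m = zero}  D S p = refl
  commonOutAll≡all {m = suc m} D S p with p zero
  ... | true  = commonOutAll≡all D S (λ i → p (suc i))
  ... | false = refl

  commonOutTest≡isCommonOut : ∀ {n t} (D : Digraph n) (S : Fin t → Fin n) w →
                              commonOutTest D S w ≡ isCommonOut D S w
  commonOutTest≡isCommonOut {t = zero}  D S w = refl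
  commonOutTest≡isCommonOut {t = suc t} D S w =
    trans (commonOutTest-suc D S w) (if-then-false (arc D (S zero) w))
    where
    if-then-false : ∀ b → (if b then commonOutAll D S (λ i → arc D (S (suc i)) w) else false)
                          ≡ b ∧ all (λ i → arc D (S (suc i)) w)
    if-then-false true  = commonOutAll≡all D S (λ i → arc D (S (suc i)) w)
    if-then-false false = refl

commonOut≡count-isCommonOut : ∀ {n t} (D : Digraph n) (S : Fin t → Fin n) →
                              commonOut D S ≡ count (isCommonOut D S)
commonOut≡count-isCommonOut D S =
  trans (commonOut≡count-test D S) (count-cong (commonOutTest≡isCommonOut D S))

∷-injective : ∀ {n s} {x : Fin n} {T : Fin s → Fin n} →
              Injective _≡_ _≡_ T → outside T x ≡ true → Injective _≡_ _≡_ (x ∷ T)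
∷-injective inj x∉T {zero}  {zero}  _     = refl
∷-injective inj x∉T {zero}  {suc j} x≡Tj  = ⊥-elim (not⌊≟⌋⇒≢ (all-elim x∉T j) (sym x≡Tj))
∷-injective inj x∉T {suc i} {zero}  Ti≡x  = ⊥-elim (not⌊≟⌋⇒≢ (all-elim x∉T i) Ti≡x)
∷-injective inj x∉T {suc i} {suc j} Ti≡Tj = cong suc (inj Ti≡Tj)

injection-avoiding : ∀ {n s} (u v : Fin n) → u ≢ v → 2 + s ≤ n →
  ∃[ T ] (Injective _≡_ _≡_ T × outside {s = s} T u ≡ true × outside T v ≡ true)
injection-avoiding {suc (suc n)} u v u≢v (s≤s (s≤s s≤n)) =
  T , injective , all-intro (≢⇒not⌊≟⌋ ∘ ≢u) , all-intro (≢⇒not⌊≟⌋ ∘ ≢v)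
  where
  v′ : Fin (suc n)
  v′ = punchOut u≢v
  T : Fin _ → Fin (suc (suc n))
  T i = punchIn u (punchIn v′ (inject≤ i s≤n))
  injective : Injective _≡_ _≡_ T
  injective {i} {j} = inject≤-injective s≤n s≤n i j ∘ punchIn-injective v′ _ _ ∘ punchIn-injective u _ _
  ≢u : ∀ i → T i ≢ u
  ≢u i = punchInᵢ≢i u (punchIn v′ (inject≤ i s≤n))
  ≢v : ∀ i → T i ≢ v
  ≢v i Ti≡v = punchInᵢ≢i v′ (inject≤ i s≤n)
                (punchIn-injective u _ _ (trans Ti≡v (sym (punchIn-punchOut u≢v))))

count-outside : ∀ {n s} (T : Fin s → Fin n) → Injective _≡_ _≡_ T → (p : Fin n → Bool) →
                (∀ i → p (T i) ≡ true) → count p ≡ s + count (λ x → outside T x ∧ p x)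
count-outside {s = zero}  T _   p _  = refl
count-outside {s = suc s} T inj p pT = begin
  count p                                  ≡⟨ count-outside (T ∘ suc) (suc-injective ∘ inj) p (pT ∘ suc) ⟩
  s + count q                              ≡⟨ cong (s +_) (count-remove q (cong₂ _∧_ T₀∉T∘suc (pT zero))) ⟩
  s + suc (count (q ∖ T zero))             ≡⟨ +-suc s _ ⟩
  suc s + count (q ∖ T zero)               ≡⟨ cong (suc s +_) (count-cong reassociate) ⟨
  suc s + count (λ x → outside T x ∧ p x)  ∎
  where
  open ≡-Reasoning
  q : Fin _ → Bool
  q x = outside (T ∘ suc) x ∧ p x
  T₀∉T∘suc : outside (T ∘ suc) (T zero) ≡ true
  T₀∉T∘suc = all-intro {p = λ i → not ⌊ T (suc i) ≟ T zero ⌋}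
                       (λ i → ≢⇒not⌊≟⌋ (λ Ti≡T₀ → 0≢1+n (inj (sym Ti≡T₀))))
  reassociate : ∀ x → outside T x ∧ p x ≡ (q ∖ T zero) x
  reassociate x = ∧-assoc (not ⌊ T zero ≟ x ⌋) (outside (T ∘ suc) x) (p x)

n≡s+count-outside : ∀ {n s} (T : Fin s → Fin n) → Injective _≡_ _≡_ T → n ≡ s + count (outside T)
n≡s+count-outside {n} {s} T inj = begin
  n                                     ≡⟨ count-true {n} ⟨
  count {n} (λ _ → true)                ≡⟨ count-outside T inj (λ _ → true) (λ _ → refl) ⟩
  s + count (λ x → outside T x ∧ true)  ≡⟨ cong (s +_) (count-cong (λ x → ∧-identityʳ (outside T x))) ⟩
  s + count (outside T)                 ∎
  where open ≡-Reasoning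

module _ {n} (D : Digraph n) where

  isCommonOut⊆outside : ∀ {s} (T : Fin s → Fin n) → isCommonOut D T ⊆ outside T
  isCommonOut⊆outside T w common = all-intro (≢⇒not⌊≟⌋ ∘ not-loop)
    where
    not-loop : ∀ i → T i ≢ w
    not-loop i Ti≡w
      with () ← trans (sym (all-elim common i)) (trans (cong (λ u → arc D u w) Ti≡w) (loopless D w))

  indeg-< : ∀ w → indeg D w < n
  indeg-< w = subst (indeg D w <_) count-true
    (count-⊂ {p = λ u → arc D u w} {q = λ _ → true} {a = w} (λ _ _ → refl) refl (loopless D w))

  outside⊆isCommonOut : ∀ {k l s} → (∀ w → indeg D w ≡ k) → 0 < l → Liking (2 + s) l D →
                        (T : Fin s → Fin n) → Injective _≡_ _≡_ T → outside T ⊆ isCommonOut D T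
  outside⊆isCommonOut {k} {l} {s} in-regular 0<l (t≤n , liking) T inj =
    ⊆∧count≥⇒⊇ (isCommonOut⊆outside T)
      (Fisher.fisher-inequality (outside T) (isCommonOut D T) (arc D) block-size pair-count 0<l 2≤N K<N)
    where
    N : ℕ
    N = count (outside T)
    block-size : ∀ w → isCommonOut D T w ≡ true → count (λ x → outside T x ∧ arc D x w) ≡ k ∸ s
    block-size w common = begin
      count (λ x → outside T x ∧ arc D x w)
        ≡⟨ m+n∸m≡n s _ ⟨
      s + count (λ x → outside T x ∧ arc D x w) ∸ s
        ≡⟨ cong (_∸ s) (count-outside T inj (λ u → arc D u w) (all-elim common)) ⟨
      indeg D w ∸ s
        ≡⟨ cong (_∸ s) (in-regular w) ⟩
      k ∸ s
        ∎
      where open ≡-Reasoning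
    pair-count : ∀ x y → outside T x ≡ true → outside T y ≡ true → x ≢ y →
                 count (λ w → arc D x w ∧ (arc D y w ∧ isCommonOut D T w)) ≡ l
    pair-count x y x∉T y∉T x≢y = trans (sym (commonOut≡count-isCommonOut D (x ∷ (y ∷ T))))
      (liking (x ∷ (y ∷ T))
              (∷-injective (∷-injective inj y∉T) (cong₂ _∧_ (≢⇒not⌊≟⌋ (≢-sym x≢y)) x∉T)))
    2≤N : 2 ≤ N
    2≤N = +-cancelˡ-≤ s 2 N (subst₂ _≤_ (+-comm 2 s) (n≡s+count-outside T inj) t≤n)
    K<N : k ∸ s < N
    K<N = m<n+o⇒m∸n<o k s {{>-nonZero (≤-trans (s≤s z≤n) 2≤N)}}
            (subst₂ _<_ (in-regular v) (n≡s+count-outside T inj) (indeg-< v))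
      where
      v : Fin n
      v = Fin.fromℕ< (≤-trans (s≤s z≤n) t≤n)

  arcs-between-distinct : ∀ {k l s} → (∀ w → indeg D w ≡ k) → 0 < l → Liking (3 + s) l D →
                          ∀ u v → u ≢ v → arc D u v ≡ true
  arcs-between-distinct in-regular 0<l liking u v u≢v
    with injection-avoiding u v u≢v (≤-trans (n≤1+n _) (proj₁ liking))
  ... | T , inj , u∉T , v∉T = ∧-conicalˡ (arc D u v) _
          (outside⊆isCommonOut in-regular 0<l liking (u ∷ T) (∷-injective inj u∉T) v
                               (cong₂ _∧_ (≢⇒not⌊≟⌋ u≢v) v∉T))

  arc≡not⌊≟⌋ : (∀ u v → u ≢ v → arc D u v ≡ true) → ∀ u v → arc D u v ≡ not ⌊ u ≟ v ⌋
  arc≡not⌊≟⌋ distinct u v with u ≟ v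
  ... | yes refl = loopless D u
  ... | no u≢v   = distinct u v u≢v

  vertex-count : ∀ {t l} → Liking t l D → (∀ u v → arc D u v ≡ not ⌊ u ≟ v ⌋) → n ≡ t + l
  vertex-count {t} {l} (t≤n , liking) arc≡ = begin
    n                            ≡⟨ n≡s+count-outside S injective ⟩
    t + count (outside S)        ≡⟨ cong (t +_) (count-cong (λ x → all-cong (λ i → arc≡ (S i) x))) ⟨
    t + count (isCommonOut D S)  ≡⟨ cong (t +_) (commonOut≡count-isCommonOut D S) ⟨
    t + commonOut D S            ≡⟨ cong (t +_) (liking S injective) ⟩
    t + l                        ∎
    where
    open ≡-Reasoning
    S : Fin t → Fin n
    S i = inject≤ i t≤n
    injective : Injective _≡_ _≡_ S
    injective {i} {j} = inject≤-injective t≤n t≤n i j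

≅-complete : ∀ {n m} (D : Digraph n) → n ≡ m → (∀ u v → arc D u v ≡ not ⌊ u ≟ v ⌋) →
             D ≅ complete m
≅-complete {n} D refl arc≡ = ↔-id (Fin n) , arc≡

proposition2p7 : (t l : ℕ) → 0 < l → 3 ≤ t → (n : ℕ) → (D : Digraph n) →
                   Diregular D → Liking t l D → D ≅ complete (t + l)
proposition2p7 t l 0<l (s≤s (s≤s (s≤s _))) n D (_ , _ , degrees) liking =
  ≅-complete D (vertex-count D liking arc≡) arc≡
  where
  arc≡ : ∀ u v → arc D u v ≡ not ⌊ u ≟ v ⌋
  arc≡ = arc≡not⌊≟⌋ D (arcs-between-distinct D (proj₂ ∘ degrees) 0<l liking)
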